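{- For every initial secret distribution $I$ and all call sequences $\sigma,\tau$ with $\sigma$ a prefix of $\tau$: if $I,\sigma\models E_A\mathrm{cExp}_A$ then $I,\tau\models E_A\mathrm{cExp}_A$.
   Context: Fix a finite set $A$ of agents, $|A|\ge 2$. Secret values are the elements of $A\times\{0,1\}$; write $b$ for $(b,1)$ and $\overline{b}$ for $(b,0)$. For $B\subseteq A\times\{0,1\}$ and $c\in A$, $B^{\pm c}$ is $B$ with the values $c$ and $\overline c$ swapped: simultaneously, $c$ is replaced by $\overline c$ and $\overline c$ by $c$. A secret distribution is a map $S:A\to\mathcal P(A\times\{0,1\})$, $a\mapsto S_a$ (the holding of $a$). An initial secret distribution $I$ satisfies $I_a\in\{\{a\},\{\overline a\}\}$ for every $a$. Calls: for $a\neq b$ in $A$ and $c\in A$ there is the correct call $ab$ (agent $a$ calls $b$ and they exchange their holdings), the faulty call $a^cb$ (from $a$ to $b$, with a transmission error on secret $c$ in what $a$ sends, so that $b$ receives $a$'s holding with the values of $c$ swapped), and the faulty call $ab^c$ (from $a$ to $b$, with a transmission error on secret $c$ in what $b$ sends to $a$). A call sequence is a finite sequence of calls containing at most one faulty call. $\epsilon$ is the empty sequence and $\sigma.\kappa$ appends the call $\kappa$. A gossip state is a pair $(I,\sigma)$ with $I$ initial and $\sigma$ a call sequence. Formulas: $\varphi::=b_a\mid\overline b_a\mid\neg\varphi\mid\varphi\wedge\varphi\mid K_a\varphi$ with $a,b\in A$. Abbreviations: - $E_A\varphi:=\bigwedge_{a\in A}K_a\varphi$; - $\mathrm{cExp}_a:=\bigwedge_{b\in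 A}((b_b\wedge b_a\wedge\neg\overline b_a)\vee(\overline b_b\wedge\neg b_a\wedge\overline b_a))$ and $\mathrm{cExp}_A:=\bigwedge_{a\in A}\mathrm{cExp}_a$. The following three notions are defined by simultaneous recursion on the length of the call sequence and on the structure of formulas. (1) Secret distribution after a call sequence. $I[\epsilon]=I$. Let $a\neq b$. If the call $\kappa$ does not involve $a$, then $I[\sigma.\kappa]_a=I[\sigma]_a$. If $\kappa\in\{ab,ba,a^cb,ba^c\}$, let $R=I[\sigma]_b$; if $\kappa\in\{ab^c,b^ca\}$, let $R=I[\sigma]_b^{\pm c}$. Then $I[\sigma.\kappa]_a=(I[\sigma]_a\cup(R\setminus *))\setminus **$, where $*=\{d: I,\sigma\models K_a\overline d_d\}\cup\{\overline d: I,\sigma\models K_a d_d\}$, and $**$ is the set of values $d$ such that $T,\tau\models\overline d_d$ for all gossip states $(T,\tau)$ with $(I,\sigma)\sim_a(T,\tau)$ and $I[\sigma]_b=T[\tau]_b$, together with the values $\overline d$ such that $T,\tau\models d_d$ for all such $(T,\tau)$. When $\kappa\in\{ab^c,b^ca\}$, the condition $I[\sigma]_b=T[\tau]_b$ is replaced by $I[\sigma]_b=T[\tau]_b^{\pm c}$. (2) Observation relation. $\sim_a$ is the equivalence closure of the following clauses, for $b\neq a$ and $e\in A$: - $(I,\epsilon)\sim_a(T,\epsilon)$ iff $I_a=T_a$; - $(I,\sigma.ab)\sim_a(T,\tau.ab)$ iff $(I,\sigma)\sim_a(T,\tau)$ and $I[\sigma]_b=T[\tau]_b$; - $(I,\sigma.ab)\sim_a(T,\tau.a^eb)$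 iff $(I,\sigma)\sim_a(T,\tau)$ and $I[\sigma]_b=T[\tau]_b$; - $(I,\sigma.ab)\sim_a(T,\tau.ab^e)$ iff $(I,\sigma)\sim_a(T,\tau)$ and $I[\sigma]_b=T[\tau]_b^{\pm e}$; - the same three clauses with $ba,ba^e,b^ea$ in place of $ab,a^eb,ab^e$; - for a call $\kappa$ (correct or faulty) and a correct call $\kappa'$, neither involving $a$: $(I,\sigma.\kappa)\sim_a(T,\tau.\kappa')$ iff $(I,\sigma)\sim_a(T,\tau)$. Only pairs whose components are call sequences are related. (3) Satisfaction. - $I,\sigma\models b_a$ iff $b\in I[\sigma]_a$; - $I,\sigma\models\overline b_a$ iff $\overline b\in I[\sigma]_a$; - the Boolean clauses are standard; - $I,\sigma\models K_a\varphi$ iff $T,\tau\models\varphi$ for all gossip states $(T,\tau)$ with $(T,\tau)\sim_a(I,\sigma)$. -}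

module Defs where

open import Data.Nat using (ℕ; zero; suc)
open import Data.Fin using (Fin; _≟_) renaming (zero to fz; suc to fs)
open import Data.Bool using (Bool; true; false; not; if_then_else_)
open import Data.Product using (_×_; _,_)
open import Data.Sum using (_⊎_)
open import Data.Maybe using (Maybe; just; nothing)
open import Data.Empty using (⊥)
open import Relation.Nullary using (¬_; yes; no)
open import Relation.Nullary.Decidable using (⌊_⌋)
open import Relation.Binary.PropositionalEquality using (_≡_; _≢_)
open import Relation.Binary.Construct.Closure.Equivalence using (EqClosure)
open import Function.Bundles using (_⇔_)

module Gossip (m : ℕ) where

  Agent : Set
  Agent = Fin (suc (suc m))

  -- secret values: (b , true) is b, (b , false) is b̄
  Val : Set
  Val = Agent × Bool

  -- initial secret distribution: I_a = {(a , I a)}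
  Init : Set
  Init = Agent → Bool

  data Call : Bool → Set where
    call  : (a b : Agent) → a ≢ b → Call false
    ffrom : (a c b : Agent) → a ≢ b → Call true         -- a^c b : error on c in what a sends
    fto   : (a b c : Agent) → a ≢ b → Call true         -- a b^c : error on c in what b sends

  Involves : ∀ {g} → Agent → Call g → Set
  Involves x (call a b _)    = x ≡ a ⊎ x ≡ b
  Involves x (ffrom a _ b _) = x ≡ a ⊎ x ≡ b
  Involves x (fto a b _ _)   = x ≡ a ⊎ x ≡ b

  -- call sequences of length n (snoc lists) with at most one faulty call;
  -- the Bool index records whether the faulty call has been used
  infixl 5 _∙_ _∙!_
  data Seq : ℕ → Bool → Set where
    ε    : Seq zero false
    _∙_  : ∀ {n f} → Seq n f → Call false → Seq (suc n) f
    _∙!_ : ∀ {n} → Seq n false → Call true → Seq (suc n) true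

  data Prefix {n f} (σ : Seq n f) : ∀ {k g} → Seq k g → Set where
    here   : Prefix σ σ
    there  : ∀ {k g} {τ : Seq k g} {κ : Call false} → Prefix σ τ → Prefix σ (τ ∙ κ)
    there! : ∀ {k} {τ : Seq k false} {κ : Call true} → Prefix σ τ → Prefix σ (τ ∙! κ)

  data GState (n : ℕ) : Set where
    gs : ∀ {f} → Init → Seq n f → GState n

  data Form : Set where
    sec  : Agent → Agent → Form      -- sec b a  is  b_a
    nsec : Agent → Agent → Form      -- nsec b a is  b̄_a
    ¬'_  : Form → Form
    _∧'_ : Form → Form → Form
    K    : Agent → Form → Form

  _∨'_ : Form → Form → Form
  φ ∨' ψ = ¬' ((¬' φ) ∧' (¬' ψ))

  bigAnd : ∀ {k} → (Fin (suc k) → Form) → Form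
  bigAnd {zero}  F = F fz
  bigAnd {suc k} F = F fz ∧' bigAnd {k} (λ i → F (fs i))

  E-A : Form → Form
  E-A φ = bigAnd (λ a → K a φ)

  cExp : Agent → Form
  cExp a = bigAnd (λ b → ((sec b b ∧' sec b a) ∧' (¬' nsec b a))
                      ∨' ((nsec b b ∧' (¬' sec b a)) ∧' nsec b a))

  cExp-A : Form
  cExp-A = bigAnd cExp

  Holding : Set₁
  Holding = Val → Set

  SameH : Holding → Holding → Set
  SameH B C = ∀ v → B v ⇔ C v

  swapV : Agent → Val → Val
  swapV c (d , t) = if ⌊ d ≟ c ⌋ then (d , not t) else (d , t)

  swapM : Maybe Agent → Holding → Holding
  swapM nothing  B = B
  swapM (just c) B v = B (swapV c v)

  record Level (n : ℕ) : Set₁ where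
    field
      hold : GState n → Agent → Holding
      rel  : Agent → GState n → GState n → Set
  open Level public

  SatL : ∀ {n} → Level n → GState n → Form → Set
  SatL L s (sec b a)  = hold L s a (b , true)
  SatL L s (nsec b a) = hold L s a (b , false)
  SatL L s (¬' φ)     = ¬ SatL L s φ
  SatL L s (φ ∧' ψ)   = SatL L s φ × SatL L s ψ
  SatL L s (K a φ)    = ∀ t → rel L a t s → SatL L t φ

  -- if x is involved in κ: its partner, and the secret on which what x
  -- receives is corrupted (if any)
  receives : ∀ {g} → Agent → Call g → Maybe (Agent × Maybe Agent)
  receives x (call a b _) with x ≟ a | x ≟ b
  ... | yes _ | _     = just (b , nothing)
  ... | no _  | yes _ = just (a , nothing)
  ... | no _  | no _  = nothing
  receives x (ffrom a c b _) with x ≟ a | x ≟ b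
  ... | yes _ | _     = just (b , nothing)
  ... | no _  | yes _ = just (a , just c)
  ... | no _  | no _  = nothing
  receives x (fto a b c _) with x ≟ a | x ≟ b
  ... | yes _ | _     = just (b , just c)
  ... | no _  | yes _ = just (a , nothing)
  ... | no _  | no _  = nothing

  Star : ∀ {n} → Level n → GState n → Agent → Val → Set
  Star L s x (d , true)  = SatL L s (K x (nsec d d))
  Star L s x (d , false) = SatL L s (K x (sec d d))

  DStar : ∀ {n} → Level n → GState n → Agent → Agent → Maybe Agent → Val → Set
  DStar L s x b ms (d , true)  =
    ∀ t → rel L x s t → SameH (hold L s b) (swapM ms (hold L t b)) → SatL L t (nsec d d)
  DStar L s x b ms (d , false) =
    ∀ t → rel L x s t → SameH (hold L s b) (swapM ms (hold L t b)) → SatL L t (sec d d)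

  updHold : ∀ {n g} → Level n → GState n → Call g → Agent → Holding
  updHold L s κ x with receives x κ
  ... | nothing = hold L s x
  ... | just (b , ms) = λ v →
        (hold L s x v ⊎ (swapM ms (hold L s b) v × ¬ Star L s x v)) × ¬ DStar L s x b ms v

  data Gen {n} (L : Level n) (x : Agent) : GState (suc n) → GState (suc n) → Set where
    ab-ab   : ∀ {f g I T} {σ : Seq n f} {τ : Seq n g} {b} (p p' : x ≢ b) →
              rel L x (gs I σ) (gs T τ) → SameH (hold L (gs I σ) b) (hold L (gs T τ) b) →
              Gen L x (gs I (σ ∙ call x b p)) (gs T (τ ∙ call x b p'))
    ab-aeb  : ∀ {f I T} {σ : Seq n f} {τ : Seq n false} {b e} (p p' : x ≢ b) →
              rel L x (gs I σ) (gs T τ) → SameH (hold L (gs I σ) b) (hold L (gs T τ) b) →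
              Gen L x (gs I (σ ∙ call x b p)) (gs T (τ ∙! ffrom x e b p'))
    ab-abe  : ∀ {f I T} {σ : Seq n f} {τ : Seq n false} {b e} (p p' : x ≢ b) →
              rel L x (gs I σ) (gs T τ) →
              SameH (hold L (gs I σ) b) (swapM (just e) (hold L (gs T τ) b)) →
              Gen L x (gs I (σ ∙ call x b p)) (gs T (τ ∙! fto x b e p'))
    ba-ba   : ∀ {f g I T} {σ : Seq n f} {τ : Seq n g} {b} (p p' : b ≢ x) →
              rel L x (gs I σ) (gs T τ) → SameH (hold L (gs I σ) b) (hold L (gs T τ) b) →
              Gen L x (gs I (σ ∙ call b x p)) (gs T (τ ∙ call b x p'))
    ba-bae  : ∀ {f I T} {σ : Seq n f} {τ : Seq n false} {b e} (p p' : b ≢ x) →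
              rel L x (gs I σ) (gs T τ) → SameH (hold L (gs I σ) b) (hold L (gs T τ) b) →
              Gen L x (gs I (σ ∙ call b x p)) (gs T (τ ∙! fto b x e p'))
    ba-bea  : ∀ {f I T} {σ : Seq n f} {τ : Seq n false} {b e} (p p' : b ≢ x) →
              rel L x (gs I σ) (gs T τ) →
              SameH (hold L (gs I σ) b) (swapM (just e) (hold L (gs T τ) b)) →
              Gen L x (gs I (σ ∙ call b x p)) (gs T (τ ∙! ffrom b e x p'))
    other   : ∀ {f g I T} {σ : Seq n f} {τ : Seq n g} {κ κ' : Call false} →
              ¬ Involves x κ → ¬ Involves x κ' →
              rel L x (gs I σ) (gs T τ) →
              Gen L x (gs I (σ ∙ κ)) (gs T (τ ∙ κ'))
    other!  : ∀ {g I T} {σ : Seq n false} {τ : Seq n g} {κ : Call true} {κ' : Call false} →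
              ¬ Involves x κ → ¬ Involves x κ' →
              rel L x (gs I σ) (gs T τ) →
              Gen L x (gs I (σ ∙! κ)) (gs T (τ ∙ κ'))

  hold0 : GState zero → Agent → Holding
  hold0 (gs I ε) x v = v ≡ (x , I x)

  rel0 : Agent → GState zero → GState zero → Set
  rel0 x (gs I ε) (gs T ε) = I x ≡ T x

  holdS : ∀ {n} → Level n → GState (suc n) → Agent → Holding
  holdS L (gs I (σ ∙ κ))  = updHold L (gs I σ) κ
  holdS L (gs I (σ ∙! κ)) = updHold L (gs I σ) κ

  step : ∀ {n} → Level n → Level (suc n)
  step L = record { hold = holdS L ; rel = λ x → EqClosure (Gen L x) }

  level : (n : ℕ) → Level n
  level zero    = record { hold = hold0 ; rel = rel0 }
  level (suc n) = step (level n)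

  _,_⊨_ : ∀ {n f} → Init → Seq n f → Form → Set
  I , σ ⊨ φ = SatL (level _) (gs I σ) φ

{-# OPTIONS --safe #-}
module Submission where

-- Call a state expert if every agent holds every secret with exactly the value
-- its owner holds (cExp_A).  A correct call keeps a state expert: whatever an
-- agent receives was held by someone, hence agrees with its own value, and **
-- discards nothing, since the actual state is among the alternatives it
-- quantifies over and there the owner holds the value in question.  Faulty
-- calls are excluded by E_A cExp_A: an agent who considers a fault-free history
-- possible also considers possible the same history with its last call
-- replaced by one corrupting the caller's own secret in transit (for the empty
-- history, the initial state itself), and that state is not expert.  So if
-- E_A cExp_A holds before a call, every state an agent considers possible after
-- it arises by a correct call from a state it considered possible before, which
-- is expert.

open import Defs
open import Data.Nat using (ℕ; zero; suc)
open import Data.Bool using (Bool; true; false; not)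
open import Data.Bool.Properties using (not-¬; ¬-not) renaming (_≟_ to _≟ᵇ_)
open import Data.Fin using (Fin; _≟_) renaming (zero to fz; suc to fs)
open import Data.Product using (_×_; _,_; proj₁; proj₂; ∃-syntax)
open import Data.Product.Properties using (,-injectiveˡ; ,-injectiveʳ)
open import Data.Sum using (_⊎_; inj₁; inj₂; [_,_]′)
open import Data.Maybe using (Maybe; just; nothing)
open import Data.Empty using (⊥-elim)
open import Function using (_∘_; id)
open import Function.Bundles using (_⇔_; mk⇔; Equivalence)
open import Relation.Nullary using (¬_; yes; no)
open import Relation.Nullary.Decidable using (dec-yes; dec-no)
open import Relation.Binary.Structures using (IsEquivalence)
open import Relation.Binary.PropositionalEquality using (_≡_; _≢_; refl; sym; trans; subst)
open import Relation.Binary.Construct.Closure.ReflexiveTransitive using (ε; _◅_; _◅◅_)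
open import Relation.Binary.Construct.Closure.Symmetric using (fwd; bwd)
import Relation.Binary.Construct.Closure.Equivalence as EqClosure

module Stability (m : ℕ) where
  open Gossip m
  open Equivalence using (to; from)

  variable
    n : ℕ
    L : Level n
    s : GState n

  bigAnd-elim : ∀ {k} (F : Fin (suc k) → Form) →
                SatL L s (bigAnd F) → ∀ i → SatL L s (F i)
  bigAnd-elim {k = zero}  F h fz     = h
  bigAnd-elim {k = suc k} F h fz     = proj₁ h
  bigAnd-elim {k = suc k} F h (fs i) = bigAnd-elim (F ∘ fs) (proj₂ h) i

  bigAnd-intro : ∀ {k} (F : Fin (suc k) → Form) →
                 (∀ i → SatL L s (F i)) → SatL L s (bigAnd F)
  bigAnd-intro {k = zero}  F h = h fz
  bigAnd-intro {k = suc k} F h = h fz , bigAnd-intro (F ∘ fs) (h ∘ fs)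

  E-A-elim : ∀ {φ} → SatL L s (E-A φ) → ∀ a t → rel L a t s → SatL L t φ
  E-A-elim {φ = φ} = bigAnd-elim (λ a → K a φ)

  E-A-intro : ∀ {φ} → (∀ a t → rel L a t s → SatL L t φ) → SatL L s (E-A φ)
  E-A-intro {φ = φ} = bigAnd-intro (λ a → K a φ)

  holdsCorrectly : Agent → Agent → Form
  holdsCorrectly a b = ((sec b b ∧' sec b a) ∧' (¬' nsec b a))
                    ∨' ((nsec b b ∧' (¬' sec b a)) ∧' nsec b a)

  CorrectExperts : Level n → GState n → Set
  CorrectExperts L s = ∀ a b → SatL L s (holdsCorrectly a b)

  cExp-A⇒CorrectExperts : SatL L s cExp-A → CorrectExperts L s
  cExp-A⇒CorrectExperts h a = bigAnd-elim (holdsCorrectly a) (bigAnd-elim cExp h a)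

  CorrectExperts⇒cExp-A : CorrectExperts L s → SatL L s cExp-A
  CorrectExperts⇒cExp-A h = bigAnd-intro cExp (λ a → bigAnd-intro (holdsCorrectly a) (h a))

  module _ {n} {L : Level n} {s : GState n} (ce : CorrectExperts L s) where

    CorrectExperts-consistent : ∀ x y d β → hold L s x (d , β) → ¬ hold L s y (d , not β)
    CorrectExperts-consistent x y d true hx hy =
      ce x d ( (λ ((hdt , _) , _) →
                 ce y d ( (λ (_ , ¬hyf) → ¬hyf hy)
                        , (λ ((hdf , _) , _) →
                             ce d d ( (λ (_ , ¬hdf) → ¬hdf hdf)
                                    , (λ ((_ , ¬hdt) , _) → ¬hdt hdt)))))
             , (λ ((_ , ¬hxt) , _) → ¬hxt hx))
    CorrectExperts-consistent x y d false hx hy = CorrectExperts-consistent y x d true hy hx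

    CorrectExperts-agree : ∀ x y v → hold L s x v → ¬ ¬ hold L s y v
    CorrectExperts-agree x y (d , true) hx ¬hy =
      ce y d ( (λ ((_ , hyt) , _) → ¬hy hyt)
             , (λ (_ , hyf) → CorrectExperts-consistent x y d true hx hyf))
    CorrectExperts-agree x y (d , false) hx ¬hy =
      ce y d ( (λ ((_ , hyt) , _) → CorrectExperts-consistent x y d false hx hyt)
             , (λ (_ , hyf) → ¬hy hyf))

  CorrectExperts-transfer : ∀ {n′} {L′ : Level n′} {s′ : GState n′} →
                            (∀ x v → hold L s x v → hold L′ s′ x v) →
                            (∀ x v → hold L′ s′ x v → ¬ ¬ hold L s x v) →
                            CorrectExperts L s → CorrectExperts L′ s′
  CorrectExperts-transfer ⊆ ⊇ ce a b (¬P₁ , ¬P₂) =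
    ce a b ( (λ ((hbt , hat) , ¬haf) →
               ¬P₁ ((⊆ b _ hbt , ⊆ a _ hat) , λ h → ⊇ a _ h ¬haf))
           , (λ ((hbf , ¬hat) , haf) →
               ¬P₂ ((⊆ b _ hbf , λ h → ⊇ a _ h ¬hat) , ⊆ a _ haf)))

  rel-isEquivalence : ∀ n a → IsEquivalence (rel (level n) a)
  rel-isEquivalence zero a = record
    { refl  = λ { {gs I ε} → refl }
    ; sym   = λ { {gs I ε} {gs T ε} → sym }
    ; trans = λ { {gs I ε} {gs T ε} {gs U ε} → trans }
    }
  rel-isEquivalence (suc n) a = EqClosure.isEquivalence _

  rel-refl : ∀ a (s : GState n) → rel (level n) a s s
  rel-refl {n} a s = IsEquivalence.refl (rel-isEquivalence n a)

  previous : GState (suc n) → GState n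
  previous (gs I (σ ∙ κ))  = gs I σ
  previous (gs I (σ ∙! κ)) = gs I σ

  Gen-previous : ∀ {a} {u v : GState (suc n)} →
                 Gen (level n) a u v → rel (level n) a (previous u) (previous v)
  Gen-previous (ab-ab _ _ r _)  = r
  Gen-previous (ab-aeb _ _ r _) = r
  Gen-previous (ab-abe _ _ r _) = r
  Gen-previous (ba-ba _ _ r _)  = r
  Gen-previous (ba-bae _ _ r _) = r
  Gen-previous (ba-bea _ _ r _) = r
  Gen-previous (other _ _ r)    = r
  Gen-previous (other! _ _ r)   = r

  rel-previous : ∀ a {u v : GState (suc n)} →
                 rel (level (suc n)) a u v → rel (level n) a (previous u) (previous v)
  rel-previous a = EqClosure.gfold (rel-isEquivalence _ a) previous Gen-previous

  SameH-refl : (B : Holding) → SameH B B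
  SameH-refl B v = mk⇔ id id

  swapV-self : ∀ z β → swapV z (z , β) ≡ (z , not β)
  swapV-self z β rewrite proj₂ (dec-yes (z ≟ z) refl) = refl

  receives-call : ∀ x {a b} (p : a ≢ b) →
                  receives x (call a b p) ≡ nothing
                  ⊎ ∃[ c ] receives x (call a b p) ≡ just (c , nothing)
  receives-call x {a} {b} p with x ≟ a | x ≟ b
  ... | yes _ | _     = inj₂ (b , refl)
  ... | no _  | yes _ = inj₂ (a , refl)
  ... | no _  | no _  = inj₁ refl

  receives-ffrom-caller : ∀ {a c b} (p : a ≢ b) →
                          receives a (ffrom a c b p) ≡ just (b , nothing)
  receives-ffrom-caller {a} p rewrite proj₂ (dec-yes (a ≟ a) refl) = refl

  receives-ffrom-callee : ∀ {a c b} (p : a ≢ b) →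
                          receives b (ffrom a c b p) ≡ just (a , just c)
  receives-ffrom-callee {a} {b = b} p
    rewrite dec-no (b ≟ a) (p ∘ sym) | proj₂ (dec-yes (b ≟ b) refl) = refl

  receives-fto-caller : ∀ {a b c} (p : a ≢ b) →
                        receives a (fto a b c p) ≡ just (b , just c)
  receives-fto-caller {a} p rewrite proj₂ (dec-yes (a ≟ a) refl) = refl

  receives-fto-callee : ∀ {a b c} (p : a ≢ b) →
                        receives b (fto a b c p) ≡ just (a , nothing)
  receives-fto-callee {a} {b} p
    rewrite dec-no (b ≟ a) (p ∘ sym) | proj₂ (dec-yes (b ≟ b) refl) = refl

  Updated : Level n → GState n → Agent → Agent → Maybe Agent → Holding
  Updated L s x b ms v = (hold L s x v ⊎ (swapM ms (hold L s b) v × ¬ Star L s x v))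
                       × ¬ DStar L s x b ms v

  updHold-unchanged : ∀ (L : Level n) s {g} (κ : Call g) x →
                      receives x κ ≡ nothing → ∀ v → updHold L s κ x v ⇔ hold L s x v
  updHold-unchanged L s κ x eq v with receives x κ | eq
  ... | nothing | refl = mk⇔ id id

  updHold-updated : ∀ (L : Level n) s {g} (κ : Call g) x {b ms} →
                    receives x κ ≡ just (b , ms) →
                    ∀ v → updHold L s κ x v ⇔ Updated L s x b ms v
  updHold-updated L s κ x eq v with receives x κ | eq
  ... | just _ | refl = mk⇔ id id

  DStar-elim : ∀ {x b ms d} β → DStar L s x b ms (d , β) →
               ∀ t → rel L x s t → SameH (hold L s b) (swapM ms (hold L t b)) →
               hold L t d (d , not β)
  DStar-elim true  D = D
  DStar-elim false D = D

  DStar-intro : ∀ {x b ms d} β →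
                (∀ t → rel L x s t → SameH (hold L s b) (swapM ms (hold L t b)) →
                       hold L t d (d , not β)) →
                DStar L s x b ms (d , β)
  DStar-intro true  D = D
  DStar-intro false D = D

  correct-call-keeps : ∀ {a b} (p : a ≢ b) (s : GState n) {x d β} →
                       ¬ hold (level n) s d (d , not β) →
                       hold (level n) s x (d , β) → updHold (level n) s (call a b p) x (d , β)
  correct-call-keeps {n} p s {x} {β = β} ¬flipped h with receives-call x p
  ... | inj₁ eq       = from (updHold-unchanged (level n) s (call _ _ p) x eq _) h
  ... | inj₂ (_ , eq) = from (updHold-updated (level n) s (call _ _ p) x eq _)
          (inj₁ h , λ D → ¬flipped (DStar-elim β D s (rel-refl x s) (SameH-refl _)))

  correct-call-source : ∀ (L : Level n) s {a b} (p : a ≢ b) x {v} →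
                        updHold L s (call a b p) x v → ∃[ y ] hold L s y v
  correct-call-source L s p x h with receives-call x p
  ... | inj₁ eq = x , to (updHold-unchanged L s (call _ _ p) x eq _) h
  ... | inj₂ (c , eq) with to (updHold-updated L s (call _ _ p) x eq _) h
  ...   | inj₁ hx , _        = x , hx
  ...   | inj₂ (hc , _) , _ = c , hc

  correct-call-preserves-CorrectExperts :
    ∀ {f} T (τ : Seq n f) {a b} (p : a ≢ b) →
    CorrectExperts (level n) (gs T τ) → CorrectExperts (level (suc n)) (gs T (τ ∙ call a b p))
  correct-call-preserves-CorrectExperts {n} T τ p ce =
    CorrectExperts-transfer {L = level n} {s = s₀}
                            {L′ = level (suc n)} {s′ = gs T (τ ∙ call _ _ p)}
                            kept received ce
    where
      s₀ : GState n
      s₀ = gs T τ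

      kept : ∀ x v → hold (level n) s₀ x v → updHold (level n) s₀ (call _ _ p) x v
      kept x (d , β) h = correct-call-keeps p s₀ owner-agrees h
        where
          owner-agrees : ¬ hold (level n) s₀ d (d , not β)
          owner-agrees = CorrectExperts-consistent {L = level n} {s = s₀} ce x d d β h

      received : ∀ x v → updHold (level n) s₀ (call _ _ p) x v →
                 ¬ ¬ hold (level n) s₀ x v
      received x v h with correct-call-source (level n) s₀ p x h
      ... | y , hy = CorrectExperts-agree {L = level n} {s = s₀} ce y x v hy

  faultFree-¬holds-flipped : ∀ T (τ : Seq n false) y d →
                             ¬ hold (level n) (gs T τ) y (d , not (T d))
  faultFree-¬holds-flipped T ε y d h with refl ← ,-injectiveˡ h =
    not-¬ refl (sym (,-injectiveʳ h))
  faultFree-¬holds-flipped {suc n} T (τ ∙ call a b p) y d h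
    with correct-call-source (level n) (gs T τ) p y h
  ... | z , hz = faultFree-¬holds-flipped T τ z d hz

  faultFree-holds-own : ∀ T (τ : Seq n false) z → hold (level n) (gs T τ) z (z , T z)
  faultFree-holds-own T ε z = refl
  faultFree-holds-own T (τ ∙ call a b p) z =
    correct-call-keeps p (gs T τ) (faultFree-¬holds-flipped T τ z z) (faultFree-holds-own T τ z)

  ¬CorrectExperts-initial : ∀ T → ¬ CorrectExperts (level zero) (gs T ε)
  ¬CorrectExperts-initial T ce = ce fz (fs fz) ((λ { ((_ , ()) , _) }) , (λ { (_ , ()) }))

  -- r receives z's holding with z's own secret flipped, while z receives r's
  -- intact: z keeps its true value, which r's update rule discards.
  ¬CorrectExperts-after-own-secret-corrupted :
    ∀ T (τ : Seq n false) (κ : Call true) {r z} →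
    receives r κ ≡ just (z , just z) → receives z κ ≡ just (r , nothing) →
    ¬ CorrectExperts (level (suc n)) (gs T (τ ∙! κ))
  ¬CorrectExperts-after-own-secret-corrupted {n} T τ κ {r} {z} r←z z←r ce =
    ce r z ( (λ ((hz , hr) , _) → ¬shared true hz hr)
           , (λ ((hz , _) , hr) → ¬shared false hz hr))
    where
      s₀ : GState n
      s₀ = gs T τ

      z-¬flipped : ¬ updHold (level n) s₀ κ z (z , not (T z))
      z-¬flipped h with proj₁ (to (updHold-updated (level n) s₀ κ z z←r _) h)
      ... | inj₁ hz       = faultFree-¬holds-flipped T τ z z hz
      ... | inj₂ (hr , _) = faultFree-¬holds-flipped T τ r z hr

      z-discarded : DStar (level n) s₀ r z (just z) (z , T z)
      z-discarded = DStar-intro (T z) λ t _ same →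
        subst (hold (level n) t z) (swapV-self z (T z))
              (to (same (z , T z)) (faultFree-holds-own T τ z))

      r-¬true : ¬ updHold (level n) s₀ κ r (z , T z)
      r-¬true h = proj₂ (to (updHold-updated (level n) s₀ κ r r←z _) h) z-discarded

      ¬shared : ∀ β → updHold (level n) s₀ κ z (z , β) →
                      ¬ updHold (level n) s₀ κ r (z , β)
      ¬shared β hz hr with β ≟ᵇ T z
      ... | yes refl = r-¬true hr
      ... | no β≢Tz with refl ← ¬-not β≢Tz = z-¬flipped hz

  corrupted-alternative :
    ∀ a T (τ : Seq n false) {x y} (q : x ≢ y) →
    ∃[ κ ] rel (level (suc n)) a (gs T (τ ∙! κ)) (gs T (τ ∙ call x y q))
         × ¬ CorrectExperts (level (suc n)) (gs T (τ ∙! κ))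
  corrupted-alternative a T τ {x} {y} q with a ≟ x | a ≟ y
  ... | yes refl | _ =
    ffrom a a y q ,
    bwd (ab-aeb q q (rel-refl a (gs T τ)) (SameH-refl _)) ◅ ε ,
    ¬CorrectExperts-after-own-secret-corrupted T τ (ffrom a a y q)
      (receives-ffrom-callee q) (receives-ffrom-caller q)
  ... | no _ | yes refl =
    fto x a a q ,
    bwd (ba-bae q q (rel-refl a (gs T τ)) (SameH-refl _)) ◅ ε ,
    ¬CorrectExperts-after-own-secret-corrupted T τ (fto x a a q)
      (receives-fto-caller q) (receives-fto-callee q)
  ... | no a≢x | no a≢y =
    ffrom x x y q ,
    fwd (other! [ a≢x , a≢y ]′ [ a≢x , a≢y ]′ (rel-refl a (gs T τ))) ◅ ε ,
    ¬CorrectExperts-after-own-secret-corrupted T τ (ffrom x x y q)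
      (receives-ffrom-callee q) (receives-ffrom-caller q)

  faultFree-alternative-refutes-E-cExp-A :
    ∀ a T (τ : Seq n false) s → rel (level n) a (gs T τ) s →
    ¬ SatL (level n) s (E-A cExp-A)
  faultFree-alternative-refutes-E-cExp-A a T ε s r H =
    ¬CorrectExperts-initial T (cExp-A⇒CorrectExperts (E-A-elim H a _ r))
  faultFree-alternative-refutes-E-cExp-A a T (τ ∙ call x y q) s r H
    with corrupted-alternative a T τ q
  ... | _ , r′ , ¬ce = ¬ce (cExp-A⇒CorrectExperts (E-A-elim H a _ (r′ ◅◅ r)))

  E-cExp-A-step : (u : GState (suc n)) →
                  SatL (level n) (previous u) (E-A cExp-A) → SatL (level (suc n)) u (E-A cExp-A)
  E-cExp-A-step {n} u H = E-A-intro λ a t t~u → cExp-A-at a t (rel-previous a t~u)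
    where
      cExp-A-at : ∀ a t → rel (level n) a (previous t) (previous u) →
                  SatL (level (suc n)) t cExp-A
      cExp-A-at a (gs T (τ ∙ call x y q)) r = CorrectExperts⇒cExp-A
        (correct-call-preserves-CorrectExperts T τ q (cExp-A⇒CorrectExperts (E-A-elim H a _ r)))
      cExp-A-at a (gs T (τ ∙! κ)) r =
        ⊥-elim (faultFree-alternative-refutes-E-cExp-A a T τ (previous u) r H)

proposition4 : (m : ℕ) → let open Gossip m in
    (I : Init) {n k : ℕ} {f g : Bool} (σ : Seq n f) (τ : Seq k g) →
    Prefix σ τ → I , σ ⊨ E-A cExp-A → I , τ ⊨ E-A cExp-A
proposition4 m I σ .σ Gossip.here h = h
proposition4 m I σ (τ Gossip.∙ κ) (Gossip.there p) h =
  Stability.E-cExp-A-step m (Gossip.gs I (τ Gossip.∙ κ)) (proposition4 m I σ τ p h)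
proposition4 m I σ (τ Gossip.∙! κ) (Gossip.there! p) h =
  Stability.E-cExp-A-step m (Gossip.gs I (τ Gossip.∙! κ)) (proposition4 m I σ τ p h)
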